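{- Let $A$ be a commutative ring with unity, let $D\subseteq A[z]$ be Diophantine over $A[z]$, and let $\alpha\ge 0$ be an integer. Then $D_\alpha=\{f\in D:\deg(f)\le\alpha\}$, regarded as a subset of $A^{\alpha+1}$, is a countable union of subsets of $A^{\alpha+1}$ that are Diophantine over $A$.
   Context: For a ring $R$, a set $X\subseteq R^n$ is Diophantine over $R$ if there are polynomials $F_1,\dots,F_r\in R[x_1,\dots,x_n,y_1,\dots,y_m]$ such that $X=\{\mathbf a\in R^n:\exists \mathbf b\in R^m,\ F_j(\mathbf a,\mathbf b)=0 \text{ for all } j\}$. For $X\subseteq A[z]$ and $\alpha\ge0$, $X_\alpha=\{f\in X:\deg f\le\alpha\}$; the set $A[z]_\alpha$ of polynomials of degree at most $\alpha$ is identified with $A^{\alpha+1}$ via coefficients, which allows one to speak of Diophantine subsets of $A[z]_\alpha$ over $A$. -}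

module Defs where

open import Level using (Level; _⊔_; 0ℓ) renaming (suc to lsuc)
open import Algebra.Bundles using (CommutativeRing)
open import Algebra.Bundles.Raw using (RawRing)
open import Data.Nat using (ℕ; zero; suc; _<_) renaming (_+_ to _+ℕ_)
open import Data.Fin using (Fin)
open import Data.List using (List; []; _∷_)
open import Data.Product using (Σ; ∃; _×_; _,_)
open import Data.Vec.Functional using (Vector; toList; _++_)
open import Function.Bundles using (_↣_)
open import Relation.Unary using (Pred)

-- Every element of R[x_1,...,x_k] is represented by such a term and every
-- term denotes an element of R[x_1,...,x_k]; we only use them through
-- evaluation, so this is the usual representation of polynomials.

module _ {c ℓ} (R : RawRing c ℓ) where
  open RawRing R

  data Term (k : ℕ) : Set c where
    con  : Carrier → Term k
    var  : Fin k → Term k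
    _⊕_  : Term k → Term k → Term k
    _⊗_  : Term k → Term k → Term k
    ⊖_   : Term k → Term k

  eval : ∀ {k} → Term k → Vector Carrier k → Carrier
  eval (con a)   ρ = a
  eval (var i)   ρ = ρ i
  eval (s ⊕ t)   ρ = eval s ρ + eval t ρ
  eval (s ⊗ t)   ρ = eval s ρ * eval t ρ
  eval (⊖ t)     ρ = - eval t ρ

  Diophantine : ∀ {n ℓ'} → Pred (Vector Carrier n) ℓ' → Set (c ⊔ ℓ ⊔ ℓ')
  Diophantine {n} X =
    Σ ℕ λ m → Σ ℕ λ r → Σ (Fin r → Term (n +ℕ m)) λ F →
      ∀ (a : Vector Carrier n) →
        (X a → Σ (Vector Carrier m) λ b → ∀ j → eval (F j) (a ++ b) ≈ 0#)
        × (Σ (Vector Carrier m) (λ b → ∀ j → eval (F j) (a ++ b) ≈ 0#) → X a)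

-- The polynomial ring A[z]: coefficient lists (constant term first),
-- equality = equality of all coefficients (trailing zeros irrelevant).

module Poly {c ℓ} (A : CommutativeRing c ℓ) where
  open CommutativeRing A

  Pol : Set c
  Pol = List Carrier

  coeff : Pol → ℕ → Carrier
  coeff []       _       = 0#
  coeff (a ∷ p)  zero    = a
  coeff (a ∷ p)  (suc i) = coeff p i

  _≈ₚ_ : Pol → Pol → Set ℓ
  p ≈ₚ q = ∀ i → coeff p i ≈ coeff q i

  _+ₚ_ : Pol → Pol → Pol
  []      +ₚ q       = q
  (a ∷ p) +ₚ []      = a ∷ p
  (a ∷ p) +ₚ (b ∷ q) = (a + b) ∷ (p +ₚ q)

  scale : Carrier → Pol → Pol
  scale a []      = []
  scale a (b ∷ q) = (a * b) ∷ scale a q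

  _*ₚ_ : Pol → Pol → Pol
  []      *ₚ q = []
  (a ∷ p) *ₚ q = scale a q +ₚ (0# ∷ (p *ₚ q))

  -ₚ_ : Pol → Pol
  -ₚ []      = []
  -ₚ (a ∷ p) = (- a) ∷ (-ₚ p)

  -- A[z] as a (raw) ring; z itself is the polynomial 0# ∷ 1# ∷ [].
  A[z] : RawRing c ℓ
  A[z] = record
    { Carrier = Pol ; _≈_ = _≈ₚ_ ; _+_ = _+ₚ_ ; _*_ = _*ₚ_ ; -_ = -ₚ_
    ; 0# = [] ; 1# = 1# ∷ [] }

  -- deg f ≤ α  (the zero polynomial has degree -∞ ≤ α)
  DegLe : ℕ → Pol → Set ℓ
  DegLe α f = ∀ i → α < i → coeff f i ≈ 0#

  -- identification A^{α+1} ≅ A[z]_α via coefficients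
  fromCoeffs : ∀ {α} → Vector Carrier (suc α) → Pol
  fromCoeffs = toList

  -- D_α = {f ∈ D | deg f ≤ α}, regarded as a subset of A^{α+1}
  -- (D ⊆ A[z] is given as a subset of A[z]^1)
  Trunc : ∀ {ℓ'} → Pred (Vector Pol 1) ℓ' → (α : ℕ) → Pred (Vector Carrier (suc α)) ℓ'
  Trunc D α a = D (λ _ → fromCoeffs a)

CountableUnionOfDiophantine : ∀ {c ℓ ℓ'} (R : RawRing c ℓ) {n : ℕ} →
  Pred (Vector (RawRing.Carrier R) n) ℓ' → Set (lsuc (c ⊔ ℓ) ⊔ ℓ')
CountableUnionOfDiophantine {c} {ℓ} R {n} X =
  Σ Set λ I → (I ↣ ℕ) × Σ (I → Pred (Vector (RawRing.Carrier R) n) (c ⊔ ℓ)) λ S →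
    (∀ i → Diophantine R (S i)) ×
    (∀ a → (X a → ∃ λ i → S i a) × ((∃ λ i → S i a) → X a))

-- A polynomial of degree ≤ α is its vector of α+1 coefficients. Once the
-- witnesses b₁,…,bₘ ∈ A[z] for membership in D are required to have given
-- lengths ℓ₁,…,ℓₘ, each equation F_j(f, b) = 0 in A[z] says that finitely many
-- polynomials over A in the coefficients of f and of the b_k vanish. Hence D_α
-- is the union, over the countably many tuples ℓ ∈ ℕᵐ, of sets that are
-- Diophantine over A.
module Submission where

open import Defs
open import Level using (_⊔_)
open import Algebra.Bundles using (CommutativeRing)
open import Algebra.Bundles.Raw using (RawRing)
open import Data.Nat using (ℕ; zero; suc; _+_)
open import Data.Nat.Properties using (+-identityʳ; +-suc)
open import Data.Fin using (Fin; zero; suc; _↑ˡ_; _↑ʳ_)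
open import Data.List as List using (List; []; _∷_; length; lookup)
open import Data.List.Properties using (tabulate-cong; tabulate-lookup; map-tabulate)
open import Data.List.Relation.Unary.All using (All; []; _∷_)
open import Data.List.Relation.Unary.All.Properties
  using (map⁺; map⁻; concat⁺; concat⁻; tabulate⁺; tabulate⁻)
open import Data.Product using (Σ; ∃; _×_; _,_; proj₁; proj₂; map₂)
open import Data.Vec.Functional using (Vector; toList; _++_; foldr; tail)
open import Data.Vec.Functional.Properties using (lookup-++ˡ; lookup-++ʳ)
open import Function using (_∘_)
open import Function.Bundles using (_⇔_; mk⇔; Equivalence)
open import Function.Construct.Identity using (↣-id; ⇔-id)
open import Relation.Binary.PropositionalEquality
  using (_≡_; refl; sym; trans; cong; cong₂; subst; _≗_)
open import Relation.Unary using (Pred)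

open Equivalence using (to; from)

next : ℕ × ℕ → ℕ × ℕ
next (zero  , y) = suc y , 0
next (suc x , y) = x , suc y

-- Cantor's enumeration of ℕ × ℕ, one anti-diagonal x + y = k after another;
-- the anti-diagonal of (k , 0) starts at the triangular number diagonalStart k.
unpair : ℕ → ℕ × ℕ
unpair zero    = 0 , 0
unpair (suc n) = next (unpair n)

unpair-walk : ∀ y {n x} → unpair n ≡ (x + y , 0) → unpair (y + n) ≡ (x , y)
unpair-walk zero    {x = x} e = trans e (cong (_, 0) (+-identityʳ x))
unpair-walk (suc y) {x = x} e =
  cong next (unpair-walk y {x = suc x} (trans e (cong (_, 0) (+-suc x y))))

diagonalStart : ℕ → ℕ
diagonalStart zero    = 0
diagonalStart (suc k) = suc (k + diagonalStart k)

unpair-diagonalStart : ∀ k → unpair (diagonalStart k) ≡ (k , 0)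
unpair-diagonalStart zero    = refl
unpair-diagonalStart (suc k) = cong next (unpair-walk k (unpair-diagonalStart k))

pair : ℕ → ℕ → ℕ
pair x y = y + diagonalStart (x + y)

unpair-pair : ∀ x y → unpair (pair x y) ≡ (x , y)
unpair-pair x y = unpair-walk y (unpair-diagonalStart (x + y))

unpairⁿ : ∀ m → ℕ → Vector ℕ m
unpairⁿ (suc m) n zero    = proj₁ (unpair n)
unpairⁿ (suc m) n (suc k) = unpairⁿ m (proj₂ (unpair n)) k

pairⁿ : ∀ m → Vector ℕ m → ℕ
pairⁿ zero    ℓ = 0
pairⁿ (suc m) ℓ = pair (ℓ zero) (pairⁿ m (tail ℓ))

unpairⁿ-pairⁿ : ∀ m (ℓ : Vector ℕ m) → unpairⁿ m (pairⁿ m ℓ) ≗ ℓ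
unpairⁿ-pairⁿ (suc m) ℓ zero    = cong proj₁ (unpair-pair (ℓ zero) (pairⁿ m (tail ℓ)))
unpairⁿ-pairⁿ (suc m) ℓ (suc k) =
  trans (cong (λ p → unpairⁿ m (proj₂ p) k) (unpair-pair (ℓ zero) (pairⁿ m (tail ℓ))))
        (unpairⁿ-pairⁿ m (tail ℓ) k)

∑ : ∀ {n} → Vector ℕ n → ℕ
∑ = foldr _+_ 0

blockIndex : ∀ {n} (ℓ : Vector ℕ n) (k : Fin n) → Fin (ℓ k) → Fin (∑ ℓ)
blockIndex ℓ zero    j = j ↑ˡ ∑ (tail ℓ)
blockIndex ℓ (suc k) j = ℓ zero ↑ʳ blockIndex (tail ℓ) k j

module _ {a} {X : Set a} where

  block : ∀ {n} (ℓ : Vector ℕ n) → Vector X (∑ ℓ) → (k : Fin n) → Vector X (ℓ k)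
  block ℓ ρ k = ρ ∘ blockIndex ℓ k

  concat : ∀ {n} (ℓ : Vector ℕ n) → ((k : Fin n) → Vector X (ℓ k)) → Vector X (∑ ℓ)
  concat {zero}  ℓ cs ()
  concat {suc n} ℓ cs = cs zero ++ concat (tail ℓ) (cs ∘ suc)

  block-concat : ∀ {n} (ℓ : Vector ℕ n) cs k → block ℓ (concat ℓ cs) k ≗ cs k
  block-concat ℓ cs zero    = lookup-++ˡ (cs zero) (concat (tail ℓ) (cs ∘ suc))
  block-concat ℓ cs (suc k) j =
    trans (lookup-++ʳ (cs zero) (concat (tail ℓ) (cs ∘ suc)) (blockIndex (tail ℓ) k j))
          (block-concat (tail ℓ) (cs ∘ suc) k j)

  All⇒lookup : ∀ {p} {P : Pred X p} {xs : List X} → All P xs → ∀ i → P (lookup xs i)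
  All⇒lookup {P = P} {xs} pxs = tabulate⁻ (subst (All P) (sym (tabulate-lookup xs)) pxs)

  lookup⇒All : ∀ {p} {P : Pred X p} {xs : List X} → (∀ i → P (lookup xs i)) → All P xs
  lookup⇒All {P = P} {xs} pxs = subst (All P) (tabulate-lookup xs) (tabulate⁺ pxs)

  toList-surjective : ∀ {n} (xs : List X) → n ≡ length xs → Σ (Vector X n) λ v → toList v ≡ xs
  toList-surjective xs refl = lookup xs , tabulate-lookup xs

module _ {c ℓ} (R : RawRing c ℓ) where
  open RawRing R using (Carrier; _≈_; 0#)

  IsRoot : ∀ {k} → Vector Carrier k → Term R k → Set ℓ
  IsRoot ρ t = eval R t ρ ≈ 0#

  diophantine-fromList : ∀ {n m ℓ'} {X : Pred (Vector Carrier n) ℓ'} (eqs : List (Term R (n + m))) →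
                         (∀ a → X a ⇔ Σ (Vector Carrier m) λ b → All (IsRoot (a ++ b)) eqs) →
                         Diophantine R X
  diophantine-fromList {m = m} eqs X⇔ =
    m , length eqs , lookup eqs , λ a →
      map₂ All⇒lookup ∘ to (X⇔ a) , from (X⇔ a) ∘ map₂ lookup⇒All

module CoefficientTerms {c ℓ} (A : CommutativeRing c ℓ) where
  open CommutativeRing A using (Carrier; _≈_; 0#) renaming (refl to ≈-refl)
  open Poly A

  R : RawRing c ℓ
  R = CommutativeRing.rawRing A

  ≈ₚ[]⇒All≈0# : ∀ p → p ≈ₚ [] → All (_≈ 0#) p
  ≈ₚ[]⇒All≈0# []      _ = []
  ≈ₚ[]⇒All≈0# (a ∷ p) z = z zero ∷ ≈ₚ[]⇒All≈0# p (z ∘ suc)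

  All≈0#⇒≈ₚ[] : ∀ {p} → All (_≈ 0#) p → p ≈ₚ []
  All≈0#⇒≈ₚ[] []       _       = ≈-refl
  All≈0#⇒≈ₚ[] (z ∷ zs) zero    = z
  All≈0#⇒≈ₚ[] (z ∷ zs) (suc i) = All≈0#⇒≈ₚ[] zs i

  eval-cong : ∀ {n} (t : Term A[z] n) {ρ ρ′ : Vector Pol n} → ρ ≗ ρ′ → eval A[z] t ρ ≡ eval A[z] t ρ′
  eval-cong (con p) e = refl
  eval-cong (var i) e = e i
  eval-cong (s ⊕ t) e = cong₂ _+ₚ_ (eval-cong s e) (eval-cong t e)
  eval-cong (s ⊗ t) e = cong₂ _*ₚ_ (eval-cong s e) (eval-cong t e)
  eval-cong (⊖ t)   e = cong -ₚ_ (eval-cong t e)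

  module _ {K : ℕ} where

    _+ᵗ_ : List (Term R K) → List (Term R K) → List (Term R K)
    []      +ᵗ q       = q
    (a ∷ p) +ᵗ []      = a ∷ p
    (a ∷ p) +ᵗ (b ∷ q) = (a ⊕ b) ∷ (p +ᵗ q)

    scaleᵗ : Term R K → List (Term R K) → List (Term R K)
    scaleᵗ a []      = []
    scaleᵗ a (b ∷ q) = (a ⊗ b) ∷ scaleᵗ a q

    _*ᵗ_ : List (Term R K) → List (Term R K) → List (Term R K)
    []      *ᵗ q = []
    (a ∷ p) *ᵗ q = scaleᵗ a q +ᵗ (con 0# ∷ (p *ᵗ q))

    -ᵗ_ : List (Term R K) → List (Term R K)
    -ᵗ []      = []
    -ᵗ (a ∷ p) = (⊖ a) ∷ (-ᵗ p)

    evalᶜ : Vector Carrier K → List (Term R K) → Pol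
    evalᶜ ρ = List.map (λ t → eval R t ρ)

    module _ (ρ : Vector Carrier K) where

      evalᶜ-+ : ∀ p q → evalᶜ ρ (p +ᵗ q) ≡ evalᶜ ρ p +ₚ evalᶜ ρ q
      evalᶜ-+ []      q       = refl
      evalᶜ-+ (a ∷ p) []      = refl
      evalᶜ-+ (a ∷ p) (b ∷ q) = cong (_ ∷_) (evalᶜ-+ p q)

      evalᶜ-scale : ∀ a q → evalᶜ ρ (scaleᵗ a q) ≡ scale (eval R a ρ) (evalᶜ ρ q)
      evalᶜ-scale a []      = refl
      evalᶜ-scale a (b ∷ q) = cong (_ ∷_) (evalᶜ-scale a q)

      evalᶜ-* : ∀ p q → evalᶜ ρ (p *ᵗ q) ≡ evalᶜ ρ p *ₚ evalᶜ ρ q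
      evalᶜ-* []      q = refl
      evalᶜ-* (a ∷ p) q = trans (evalᶜ-+ (scaleᵗ a q) (con 0# ∷ (p *ᵗ q)))
                                (cong₂ _+ₚ_ (evalᶜ-scale a q) (cong (0# ∷_) (evalᶜ-* p q)))

      evalᶜ-neg : ∀ p → evalᶜ ρ (-ᵗ p) ≡ -ₚ evalᶜ ρ p
      evalᶜ-neg []      = refl
      evalᶜ-neg (a ∷ p) = cong (_ ∷_) (evalᶜ-neg p)

      evalᶜ-con : ∀ p → evalᶜ ρ (List.map con p) ≡ p
      evalᶜ-con []      = refl
      evalᶜ-con (a ∷ p) = cong (_ ∷_) (evalᶜ-con p)

      evalᶜ-var : ∀ {n} (σ : Fin n → Fin K) → evalᶜ ρ (toList (var ∘ σ)) ≡ toList (ρ ∘ σ)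
      evalᶜ-var σ = map-tabulate (var ∘ σ) (λ t → eval R t ρ)

      IsRoot-All⇔≈ₚ[] : ∀ ts → All (IsRoot R ρ) ts ⇔ evalᶜ ρ ts ≈ₚ []
      IsRoot-All⇔≈ₚ[] ts = mk⇔ (All≈0#⇒≈ₚ[] ∘ map⁺) (map⁻ ∘ ≈ₚ[]⇒All≈0# (evalᶜ ρ ts))

    substitute : ∀ {n} → Term A[z] n → (Fin n → List (Term R K)) → List (Term R K)
    substitute (con p) xs = List.map con p
    substitute (var i) xs = xs i
    substitute (s ⊕ t) xs = substitute s xs +ᵗ substitute t xs
    substitute (s ⊗ t) xs = substitute s xs *ᵗ substitute t xs
    substitute (⊖ t)   xs = -ᵗ substitute t xs

    evalᶜ-substitute : ∀ {n} (t : Term A[z] n) xs ρ →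
                       evalᶜ ρ (substitute t xs) ≡ eval A[z] t (evalᶜ ρ ∘ xs)
    evalᶜ-substitute (con p) xs ρ = evalᶜ-con ρ p
    evalᶜ-substitute (var i) xs ρ = refl
    evalᶜ-substitute (s ⊕ t) xs ρ =
      trans (evalᶜ-+ ρ (substitute s xs) (substitute t xs))
            (cong₂ _+ₚ_ (evalᶜ-substitute s xs ρ) (evalᶜ-substitute t xs ρ))
    evalᶜ-substitute (s ⊗ t) xs ρ =
      trans (evalᶜ-* ρ (substitute s xs) (substitute t xs))
            (cong₂ _*ₚ_ (evalᶜ-substitute s xs ρ) (evalᶜ-substitute t xs ρ))
    evalᶜ-substitute (⊖ t) xs ρ =
      trans (evalᶜ-neg ρ (substitute t xs)) (cong -ₚ_ (evalᶜ-substitute t xs ρ))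

module Pieces {c ℓ ℓ'} (A : CommutativeRing c ℓ) (D : Pred (Vector (Poly.Pol A) 1) ℓ')
              (D-diophantine : Diophantine (Poly.A[z] A) D) (α : ℕ) where
  open CommutativeRing A using (Carrier)
  open Poly A
  open CoefficientTerms A

  m r : ℕ
  m = proj₁ D-diophantine
  r = proj₁ (proj₂ D-diophantine)

  F : Fin r → Term A[z] (1 + m)
  F = proj₁ (proj₂ (proj₂ D-diophantine))

  Witnesses : Vector Pol 1 → Set (c ⊔ ℓ)
  Witnesses f = Σ (Vector Pol m) λ b → ∀ j → eval A[z] (F j) (f ++ b) ≈ₚ []

  D⇒Witnesses : ∀ f → D f → Witnesses f
  D⇒Witnesses f = proj₁ (proj₂ (proj₂ (proj₂ D-diophantine)) f)

  Witnesses⇒D : ∀ f → Witnesses f → D f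
  Witnesses⇒D f = proj₂ (proj₂ (proj₂ (proj₂ D-diophantine)) f)

  -- In piece d the witnesses b₁,…,bₘ have exactly the lengths `lengths d`.
  -- Fixing lengths rather than bounding degrees avoids padding with zeros, so
  -- every identity below is a propositional equality of coefficient lists.
  lengths : ℕ → Vector ℕ m
  lengths = unpairⁿ m

  sizes : ℕ → Vector ℕ (suc m)
  sizes d zero    = suc α
  sizes d (suc k) = lengths d k

  unknowns : ∀ d → Fin (suc m) → List (Term R (∑ (sizes d)))
  unknowns d i = toList (var ∘ blockIndex (sizes d) i)

  equations : ∀ d → List (Term R (∑ (sizes d)))
  equations d = List.concat (List.tabulate λ j → substitute (F j) (unknowns d))

  equations⇔ : ∀ d ρ {P : Vector Pol (suc m)} → (∀ i → toList (block (sizes d) ρ i) ≡ P i) →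
               All (IsRoot R ρ) (equations d) ⇔ (∀ j → eval A[z] (F j) P ≈ₚ [])
  equations⇔ d ρ {P} blocks≡P = mk⇔
    (λ roots j → subst (_≈ₚ []) (value j) (to (IsRoot-All⇔≈ₚ[] ρ _) (tabulate⁻ (concat⁻ roots) j)))
    (λ zeros → concat⁺ (tabulate⁺ λ j → from (IsRoot-All⇔≈ₚ[] ρ _) (subst (_≈ₚ []) (sym (value j)) (zeros j))))
    where
    value : ∀ j → evalᶜ ρ (substitute (F j) (unknowns d)) ≡ eval A[z] (F j) P
    value j = trans (evalᶜ-substitute (F j) (unknowns d) ρ)
                    (eval-cong (F j) λ i → trans (evalᶜ-var ρ (blockIndex (sizes d) i)) (blocks≡P i))

  Piece : ℕ → Pred (Vector Carrier (suc α)) (c ⊔ ℓ)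
  Piece d a = Σ (Vector Carrier (∑ (lengths d))) λ cv → All (IsRoot R (a ++ cv)) (equations d)

  Piece-diophantine : ∀ d → Diophantine R (Piece d)
  Piece-diophantine d = diophantine-fromList R (equations d) λ a → ⇔-id _

  Piece⇒Trunc : ∀ d a → Piece d a → Trunc D α a
  Piece⇒Trunc d a (cv , roots) = Witnesses⇒D (λ _ → toList a) (b , to (equations⇔ d (a ++ cv) blocks≡) roots)
    where
    b : Vector Pol m
    b k = toList (block (sizes d) (a ++ cv) (suc k))
    blocks≡ : ∀ i → toList (block (sizes d) (a ++ cv) i) ≡ ((λ _ → toList a) ++ b) i
    blocks≡ zero    = tabulate-cong (lookup-++ˡ a cv)
    blocks≡ (suc k) = refl

  Trunc⇒Piece : ∀ a → Trunc D α a → ∃ λ d → Piece d a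
  Trunc⇒Piece a t with D⇒Witnesses (λ _ → toList a) t
  ... | b , zeros = d , concat (lengths d) (cs ∘ suc) , from (equations⇔ d _ blocks≡) zeros
    where
    d : ℕ
    d = pairⁿ m (length ∘ b)
    coefficients : ∀ k → Σ (Vector Carrier (lengths d k)) λ v → toList v ≡ b k
    coefficients k = toList-surjective (b k) (unpairⁿ-pairⁿ m (length ∘ b) k)
    -- a ++ concat (lengths d) (cs ∘ suc) is concat (sizes d) cs by definition.
    cs : (i : Fin (suc m)) → Vector Carrier (sizes d i)
    cs zero    = a
    cs (suc k) = proj₁ (coefficients k)
    blocks≡ : ∀ i → toList (block (sizes d) (concat (sizes d) cs) i) ≡ ((λ _ → toList a) ++ b) i
    blocks≡ zero    = tabulate-cong (block-concat (sizes d) cs zero)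
    blocks≡ (suc k) = trans (tabulate-cong (block-concat (sizes d) cs (suc k)))
                            (proj₂ (coefficients k))

theorem1p2 : ∀ {c ℓ ℓ'} (A : CommutativeRing c ℓ) (D : Pred (Vector (Poly.Pol A) 1) ℓ') →
    Diophantine (Poly.A[z] A) D → (α : ℕ) →
    CountableUnionOfDiophantine (CommutativeRing.rawRing A) (Poly.Trunc A D α)
theorem1p2 A D D-diophantine α =
  ℕ , ↣-id ℕ , Piece , Piece-diophantine , λ a → Trunc⇒Piece a , λ (d , p) → Piece⇒Trunc d a p
  where open Pieces A D D-diophantine α
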